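{- Let $G$ be a finite connected graph and let $(X_n)_{n\ge0}$ be generated by the negative feedback algorithm from any starting node. Then there exists a positive integer $\mathcal G$, depending only on the number of nodes of $G$, the maximum degree of a node of $G$ and the length of the longest path in $G$, such that $T_C\le \mathcal G$ (for every realization).
   Context: $T_C$ is the smallest $n$ such that $X_0,X_1,\dots,X_n$ visit all nodes of the graph. Negative feedback algorithm: for nodes $i,j$ with $(i,j)$ an edge, let $N_{ij}^{(n)}$ be the number of times $m<n$ with $X_m=i,X_{m+1}=j$ (so $N_{ij}^{(0)}=0$). Let $Nmin_i^{(n)}=\min_{j:(i,j)\text{ edge}}N_{ij}^{(n)}$, $Smin_i^{(n)}=\{j:(i,j)\text{ edge}, N_{ij}^{(n)}=Nmin_i^{(n)}\}$, $Kmin_i^{(n)}=|Smin_i^{(n)}|$. If $X_n=i$, then given the past, $X_{n+1}$ is chosen uniformly at random from $Smin_i^{(n)}$ (probability $1/Kmin_i^{(n)}$ each, probability $0$ for other nodes). -}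

module Defs where

open import Data.Nat using (ℕ; zero; suc; _+_; _≤_; _<_; _⊔_)
open import Data.Fin using (Fin)
open import Data.Fin.Properties using (_≟_)
open import Data.Bool using (Bool; true; false)
open import Data.List using (List; []; _∷_; length; foldr; map; filter)
open import Data.List.Relation.Unary.Unique.Propositional using (Unique)
open import Data.Product using (Σ; ∃; _×_; _,_)
open import Relation.Binary.PropositionalEquality using (_≡_)
open import Relation.Nullary using (¬_; does)
open import Data.Fin using () renaming (zero to fzero)
open import Data.List using (allFin)

record Graph (n : ℕ) : Set where
  field
    Adj   : Fin n → Fin n → Bool
    sym   : ∀ i j → Adj i j ≡ Adj j i
    irrefl : ∀ i → Adj i i ≡ false

open Graph public

Edge : ∀ {n} → Graph n → Fin n → Fin n → Set
Edge G i j = Adj G i j ≡ true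

data IsWalk {n} (G : Graph n) : List (Fin n) → Set where
  single : ∀ v → IsWalk G (v ∷ [])
  cons   : ∀ u v vs → Edge G u v → IsWalk G (v ∷ vs) → IsWalk G (u ∷ v ∷ vs)

data WalkFromTo {n} (G : Graph n) : Fin n → Fin n → Set where
  here  : ∀ v → WalkFromTo G v v
  step  : ∀ u w v → Edge G u w → WalkFromTo G w v → WalkFromTo G u v

Connected : ∀ {n} → Graph n → Set
Connected G = ∀ u v → WalkFromTo G u v

degree : ∀ {n} → Graph n → Fin n → ℕ
degree {n} G i = length (filter (λ j → Adj G i j ≟b true) (allFin n))
  where
    open import Data.Bool.Properties renaming (_≟_ to _≟b_)

maxDegree : ∀ {n} → Graph n → ℕ
maxDegree {n} G = foldr _⊔_ 0 (map (degree G) (allFin n))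

IsPath : ∀ {n} → Graph n → List (Fin n) → Set
IsPath G p = IsWalk G p × Unique p

-- L is the length (number of edges) of the longest path in G
IsLongestPathLength : ∀ {n} → Graph n → ℕ → Set
IsLongestPathLength G L =
  (Σ _ λ p → IsPath G p × suc L ≡ length p) ×
  (∀ p → IsPath G p → length p ≤ suc L)

-- N_{ij}^{(n)} : number of m < n with X m = i and X (m+1) = j
transCount : ∀ {k} → (ℕ → Fin k) → Fin k → Fin k → ℕ → ℕ
transCount X i j zero = 0
transCount X i j (suc m) with does (X m ≟ i) | does (X (suc m) ≟ j)
... | true | true = suc (transCount X i j m)
... | _    | _    = transCount X i j m

-- X is a realization of the negative feedback algorithm on G: at each step
-- X (n+1) is a neighbour j of X n minimising N_{X n , j}^{(n)}, i.e. X (n+1) ∈ Smin.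
-- (These are exactly the sample paths all of whose finite prefixes have positive
-- probability.)
NegFeedbackRealization : ∀ {k} → Graph k → (ℕ → Fin k) → Set
NegFeedbackRealization G X =
  ∀ n → Edge G (X n) (X (suc n)) ×
        (∀ j → Edge G (X n) j →
           transCount X (X n) (X (suc n)) n ≤ transCount X (X n) j n)

CoverTimeAtMost : ∀ {k} → (ℕ → Fin k) → ℕ → Set
CoverTimeAtMost {k} X T = ∀ (v : Fin k) → ∃ λ m → m ≤ T × X m ≡ v

{-# OPTIONS --safe #-}
module Submission where

-- Write v(x) for the number of visits to x before time n. Every departure from y goes
-- along a least-used edge, so the counts of the edges leaving y differ by at most one;
-- hence for neighbours x, y we get v(y) ≤ N (v(x) + 2). If some node is unvisited,
-- following a path of length ≤ L from it bounds every v(x) by a constant B(N, L),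
-- so n = Σₓ v(x) ≤ N B. Consequently every node is visited before time N B + 2.

open import Defs
open import Data.Nat using (ℕ; zero; suc; _+_; _*_; _≤_; _<_; z≤n; s≤s)
open import Data.Nat.Properties hiding (_≟_)
open import Data.Nat.GeneralisedArithmetic using (iterate)
open import Data.Nat.ListAction using (sum)
open import Data.Fin using (Fin)
open import Data.Fin.Properties using (_≟_)
open import Data.Product using (Σ; ∃; _×_; _,_; proj₁; proj₂)
open import Data.Sum using (_⊎_; inj₁; inj₂)
open import Data.List using (List; []; _∷_; length; map; allFin)
open import Data.List.Properties using (length-tabulate)
open import Data.List.Relation.Unary.Any using (here; there)
open import Data.List.Relation.Unary.All using ([])
open import Data.List.Relation.Unary.All.Properties using (¬Any⇒All¬)
open import Data.List.Relation.Unary.AllPairs using ([]; _∷_)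
open import Data.List.Membership.Propositional using (_∈_)
open import Data.List.Membership.Propositional.Properties using (∈-allFin)
open import Relation.Binary.PropositionalEquality
  using (_≡_; _≢_; refl; trans; cong; subst)
  renaming (sym to ≡-sym)
open import Relation.Nullary using (Dec; yes; no)
open import Data.Empty using (⊥-elim)

module _ {A : Set} where

  sum-map-mono-≤ : ∀ {f g : A → ℕ} → (∀ x → f x ≤ g x) →
                   ∀ xs → sum (map f xs) ≤ sum (map g xs)
  sum-map-mono-≤ f≤g []       = ≤-refl
  sum-map-mono-≤ f≤g (x ∷ xs) = +-mono-≤ (f≤g x) (sum-map-mono-≤ f≤g xs)

  sum-map-mono-< : ∀ {f g : A → ℕ} → (∀ x → f x ≤ g x) →
                   ∀ {z} xs → z ∈ xs → f z < g z → sum (map f xs) < sum (map g xs)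
  sum-map-mono-< f≤g (x ∷ xs) (here refl) fz<gz = +-mono-<-≤ fz<gz (sum-map-mono-≤ f≤g xs)
  sum-map-mono-< f≤g (x ∷ xs) (there z∈xs) fz<gz =
    +-mono-≤-< (f≤g x) (sum-map-mono-< f≤g xs z∈xs fz<gz)

  sum-map-≤-length* : ∀ {f : A → ℕ} c → (∀ x → f x ≤ c) →
                      ∀ xs → sum (map f xs) ≤ length xs * c
  sum-map-≤-length* c f≤c []       = z≤n
  sum-map-≤-length* c f≤c (x ∷ xs) = +-mono-≤ (f≤c x) (sum-map-≤-length* c f≤c xs)

length-allFin : ∀ n → length (allFin n) ≡ n
length-allFin n = length-tabulate {n = n} (λ i → i)

data Last {A : Set} (v : A) : List A → Set where
  last-here  : Last v (v ∷ [])
  last-there : ∀ {x xs} → Last v xs → Last v (x ∷ xs)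

module _ {n : ℕ} (G : Graph n) where
  open import Data.List.Membership.DecPropositional (_≟_ {n}) using (_∈?_)

  PathFromTo : Fin n → Fin n → Set
  PathFromTo u v = Σ (List _) λ ys → IsPath G (u ∷ ys) × Last v (u ∷ ys)

  path-suffix : ∀ {u v} xs → u ∈ xs → IsPath G xs → Last v xs → PathFromTo u v
  path-suffix (x ∷ xs) (here refl) p l = xs , p , l
  path-suffix (x ∷ []) (there ()) p l
  path-suffix (x ∷ y ∷ ys) (there u∈) (cons _ _ _ _ w , _ ∷ uq) (last-there l) =
    path-suffix (y ∷ ys) u∈ (w , uq) l

  walk⇒path : ∀ {u v} → WalkFromTo G u v → PathFromTo u v
  walk⇒path (here u) = [] , (single u , [] ∷ []) , last-here
  walk⇒path {u} (step u w v e rest) with walk⇒path rest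
  ... | ys , (wk , uq) , l with u ∈? (w ∷ ys)
  ...   | yes u∈ = path-suffix (w ∷ ys) u∈ (wk , uq) l
  ...   | no  u∉ = w ∷ ys , (cons u w ys e wk , ¬Any⇒All¬ (w ∷ ys) u∉ ∷ uq) , last-there l

δ : ∀ {n} → Fin n → Fin n → ℕ
δ a v with a ≟ v
... | yes _ = 1
... | no  _ = 0

δ≤1 : ∀ {n} (a v : Fin n) → δ a v ≤ 1
δ≤1 a v with a ≟ v
... | yes _ = s≤s z≤n
... | no  _ = z≤n

δ-refl : ∀ {n} (a : Fin n) → δ a a ≡ 1
δ-refl a with a ≟ a
... | yes _  = refl
... | no a≢a = ⊥-elim (a≢a refl)

δ-≢ : ∀ {n} {a v : Fin n} → a ≢ v → δ a v ≡ 0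
δ-≢ {a = a} {v} a≢v with a ≟ v
... | yes a≡v = ⊥-elim (a≢v a≡v)
... | no  _   = refl

-- The summand b keeps the bound monotone in the path length, so shorter paths are covered too.
growth : ℕ → ℕ → ℕ
growth N b = b + N * (2 + b)

≤-iterate-growth : ∀ N b k → b ≤ iterate (growth N) b k
≤-iterate-growth N b zero    = ≤-refl
≤-iterate-growth N b (suc k) = ≤-trans (m≤m+n b _) (≤-iterate-growth N (growth N b) k)

module NegativeFeedback {N : ℕ} (G : Graph N) (X : ℕ → Fin N)
                        (R : NegFeedbackRealization G X) where

  visits : Fin N → ℕ → ℕ
  visits v zero    = 0
  visits v (suc m) = δ (X m) v + visits v m

  visits-mono : ∀ v m → visits v m ≤ visits v (suc m)
  visits-mono v m = m≤n+m (visits v m) (δ (X m) v)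

  visits-suc-≤ : ∀ v m → visits v (suc m) ≤ suc (visits v m)
  visits-suc-≤ v m = +-monoˡ-≤ (visits v m) (δ≤1 (X m) v)

  visits-hit : ∀ m → visits (X m) (suc m) ≡ suc (visits (X m) m)
  visits-hit m = cong (_+ visits (X m) m) (δ-refl (X m))

  visits-miss : ∀ {v m} → X m ≢ v → visits v (suc m) ≡ visits v m
  visits-miss {v} {m} Xm≢v = cong (_+ visits v m) (δ-≢ Xm≢v)

  visits-pos⇒visited : ∀ v n → 0 < visits v n → ∃ λ m → m < n × X m ≡ v
  visits-pos⇒visited v (suc m) pos with X m ≟ v
  ... | yes Xm≡v = m , ≤-refl , Xm≡v
  ... | no  _ with visits-pos⇒visited v m pos
  ...   | k , k<m , Xk≡v = k , m<n⇒m<1+n k<m , Xk≡v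

  n≤∑visits : ∀ n → n ≤ sum (map (λ v → visits v n) (allFin N))
  n≤∑visits zero    = z≤n
  n≤∑visits (suc m) = ≤-trans (s≤s (n≤∑visits m))
    (sum-map-mono-< (λ v → visits-mono v m) (allFin N) (∈-allFin (X m))
      (≤-reflexive (≡-sym (visits-hit m))))

  transCount-suc : ∀ i j m →
    transCount X i j (suc m) ≡ transCount X i j m ⊎
    (X m ≡ i × X (suc m) ≡ j × transCount X i j (suc m) ≡ suc (transCount X i j m))
  transCount-suc i j m with X m ≟ i | X (suc m) ≟ j
  ... | yes p | yes q = inj₂ (p , q , refl)
  ... | yes _ | no  _ = inj₁ refl
  ... | no  _ | _     = inj₁ refl

  transCount-taken : ∀ m → transCount X (X m) (X (suc m)) (suc m) ≡ suc (transCount X (X m) (X (suc m)) m)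
  transCount-taken m with X m ≟ X m | X (suc m) ≟ X (suc m)
  ... | yes _ | yes _ = refl
  ... | yes _ | no ¬q = ⊥-elim (¬q refl)
  ... | no ¬p | _     = ⊥-elim (¬p refl)

  transCount-mono : ∀ i j m → transCount X i j m ≤ transCount X i j (suc m)
  transCount-mono i j m with transCount-suc i j m
  ... | inj₁ eq           = ≤-reflexive (≡-sym eq)
  ... | inj₂ (_ , _ , eq) = ≤-trans (n≤1+n _) (≤-reflexive (≡-sym eq))

  -- y → j is taken only when its count is minimal among the edges out of y, hence not above that of y → x.
  transCount-balanced : ∀ y x → Edge G y x → ∀ j n →
                        transCount X y j n ≤ suc (transCount X y x n)
  transCount-balanced y x e j zero = z≤n
  transCount-balanced y x e j (suc m) with transCount-suc y j m
  ... | inj₁ eq = ≤-trans (≤-reflexive eq)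
        (≤-trans (transCount-balanced y x e j m) (s≤s (transCount-mono y x m)))
  ... | inj₂ (refl , refl , eq) = ≤-trans (≤-reflexive eq)
        (s≤s (≤-trans (proj₂ (R m) x e) (transCount-mono y x m)))

  transCount≤visits : ∀ y x n → transCount X y x n ≤ visits x (suc n)
  transCount≤visits y x zero    = z≤n
  transCount≤visits y x (suc m) with transCount-suc y x m
  ... | inj₁ eq = ≤-trans (≤-reflexive eq)
        (≤-trans (transCount≤visits y x m) (visits-mono x (suc m)))
  ... | inj₂ (_ , refl , eq) = ≤-trans (≤-reflexive eq)
        (≤-trans (s≤s (transCount≤visits y x m)) (≤-reflexive (≡-sym (visits-hit (suc m)))))

  departures : Fin N → ℕ → ℕ
  departures y n = sum (map (λ j → transCount X y j n) (allFin N))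

  departures-suc : ∀ y m → Dec (X m ≡ y) →
                   visits y m ≤ departures y m → visits y (suc m) ≤ departures y (suc m)
  departures-suc .(X m) m (yes refl) ih = begin
    visits (X m) (suc m)  ≡⟨ visits-hit m ⟩
    suc (visits (X m) m)  ≤⟨ s≤s ih ⟩
    suc (departures (X m) m)
      ≤⟨ sum-map-mono-< (λ j → transCount-mono (X m) j m) (allFin N) (∈-allFin (X (suc m)))
                        (≤-reflexive (≡-sym (transCount-taken m))) ⟩
    departures (X m) (suc m) ∎
    where open ≤-Reasoning
  departures-suc y m (no Xm≢y) ih = begin
    visits y (suc m)  ≡⟨ visits-miss Xm≢y ⟩
    visits y m        ≤⟨ ih ⟩
    departures y m    ≤⟨ sum-map-mono-≤ (λ j → transCount-mono y j m) (allFin N) ⟩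
    departures y (suc m) ∎
    where open ≤-Reasoning

  visits≤departures : ∀ y n → visits y n ≤ departures y n
  visits≤departures y zero    = z≤n
  visits≤departures y (suc m) = departures-suc y m (X m ≟ y) (visits≤departures y m)

  visits-neighbour : ∀ {x y} → Edge G x y → ∀ n → visits y n ≤ N * (2 + visits x n)
  visits-neighbour {x} {y} e n = begin
    visits y n                                  ≤⟨ visits≤departures y n ⟩
    departures y n                              ≤⟨ sum-map-≤-length* _ (λ j → transCount-balanced y x e′ j n) (allFin N) ⟩
    length (allFin N) * suc (transCount X y x n) ≡⟨ cong (_* suc (transCount X y x n)) (length-allFin N) ⟩
    N * suc (transCount X y x n)                ≤⟨ *-monoʳ-≤ N (s≤s (transCount≤visits y x n)) ⟩
    N * suc (visits x (suc n))                  ≤⟨ *-monoʳ-≤ N (s≤s (visits-suc-≤ x n)) ⟩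
    N * (2 + visits x n)                        ∎
    where
      open ≤-Reasoning
      e′ : Edge G y x
      e′ = trans (Graph.sym G y x) e

  visits-along-walk : ∀ n {x v} xs k b → IsWalk G (x ∷ xs) → Last v (x ∷ xs) →
                      length xs ≤ k → visits x n ≤ b → visits v n ≤ iterate (growth N) b k
  visits-along-walk n []       k b _ last-here _ x≤b = ≤-trans x≤b (≤-iterate-growth N b k)
  visits-along-walk n (y ∷ ys) (suc k) b (cons _ _ _ e w) (last-there l) (s≤s len≤k) x≤b =
    visits-along-walk n ys k (growth N b) w l len≤k
      (≤-trans (visits-neighbour e n) (≤-trans (*-monoʳ-≤ N (+-monoʳ-≤ 2 x≤b)) (m≤n+m _ b)))

  module _ (connected : Connected G) {L : ℕ} (longest : IsLongestPathLength G L) where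

    unvisited⇒visits≤ : ∀ {v n} → visits v n ≡ 0 → ∀ x → visits x n ≤ iterate (growth N) 0 L
    unvisited⇒visits≤ {v} {n} v-unvisited x with walk⇒path G (connected v x)
    ... | ys , path , l =
      visits-along-walk n ys L 0 (proj₁ path) l (≤-pred (proj₂ longest (v ∷ ys) path))
        (≤-reflexive v-unvisited)

    unvisited⇒time≤ : ∀ {v n} → visits v n ≡ 0 → n ≤ N * iterate (growth N) 0 L
    unvisited⇒time≤ {v} {n} v-unvisited = begin
      n                                 ≤⟨ n≤∑visits n ⟩
      sum (map (λ x → visits x n) (allFin N))
        ≤⟨ sum-map-≤-length* _ (unvisited⇒visits≤ {v} {n} v-unvisited) (allFin N) ⟩
      length (allFin N) * iterate (growth N) 0 L ≡⟨ cong (_* iterate (growth N) 0 L) (length-allFin N) ⟩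
      N * iterate (growth N) 0 L        ∎
      where open ≤-Reasoning

    visited-before : ∀ v → ∃ λ m → m < 2 + N * iterate (growth N) 0 L × X m ≡ v
    visited-before v with visits v (2 + N * iterate (growth N) 0 L) in eq
    ... | zero  = ⊥-elim (1+n≰n (≤-trans (n≤1+n _) (unvisited⇒time≤ eq)))
    ... | suc _ = visits-pos⇒visited v _ (subst (0 <_) (≡-sym eq) (s≤s z≤n))

coverBound : ℕ → ℕ → ℕ → ℕ
coverBound N D L = suc (N * iterate (growth N) 0 L)

theorem2 : Σ (ℕ → ℕ → ℕ → ℕ) λ 𝒢 →
    (∀ a b c → 0 < 𝒢 a b c) ×
    (∀ (N : ℕ) (G : Graph N) → Connected G →
      ∀ (L : ℕ) → IsLongestPathLength G L →
      ∀ (X : ℕ → Fin N) → NegFeedbackRealization G X →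
      CoverTimeAtMost X (𝒢 N (maxDegree G) L))
theorem2 = coverBound , (λ _ _ _ → s≤s z≤n) , covers
  where
    covers : ∀ N (G : Graph N) → Connected G → ∀ L → IsLongestPathLength G L →
             ∀ X → NegFeedbackRealization G X → CoverTimeAtMost X (coverBound N (maxDegree G) L)
    covers N G connected L longest X R v
      with NegativeFeedback.visited-before G X R connected longest v
    ... | m , m<n , Xm≡v = m , ≤-pred m<n , Xm≡v
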